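{- Let $p$ be a prime with $p \equiv 1 \pmod 4$, and let $\ell$ be a prime with $\ell \equiv 3 \pmod 4$ which splits in $\mathcal{O}_{ -p}$ and $\mathcal{O}_{ -4p}$. Then neither of the Diophantine equations $$px^2 + \ell y^2 = z^2, \qquad px^2 + pxy + \tfrac{p+\ell}{4}y^2 = z^2$$ has a solution $(x,y,z) \in \mathbb{Z}^3$ with $(x,y,z) \neq (0,0,0)$.
   Context: $\mathcal{O}_{D}$ denotes the imaginary quadratic order of discriminant $D$. -}

module Defs where

open import Data.Nat using (ℕ)
open import Data.Integer using (ℤ; +_; _*_; _-_)
open import Data.Integer.Divisibility using (_∣_)
open import Data.Product using (_×_; ∃)
open import Relation.Nullary using (¬_)

-- An odd rational prime ℓ splits in the imaginary quadratic order O_D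
-- (discriminant D < 0) iff the Kronecker symbol (D/ℓ) = 1, i.e. ℓ ∤ D and
-- D is a square modulo ℓ.  (Only used for odd primes ℓ.)
SplitsIn : ℕ → ℤ → Set
SplitsIn ℓ D = ¬ ((+ ℓ) ∣ D) × ∃ λ (t : ℤ) → (+ ℓ) ∣ (t * t - D)

{-# OPTIONS --safe #-}
module Submission where

-- The second equation reduces to the first, since 4(px² + pxy + cy²) = p(2x + y)² + ℓy²
-- when p + ℓ = 4c.  For the first, choose t with t² ≡ -p (mod ℓ).  A solution gives
-- (tx)² + z² ≡ (t² + p)x² ≡ 0 (mod ℓ).  As ℓ ≡ 3 (mod 4), ℓ ∣ a² + b² forces ℓ ∣ b:
-- otherwise ℓ ∤ a, and since (ℓ - 1)/2 is odd, a² + b² divides a^(ℓ-1) + b^(ℓ-1), which is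
-- ≡ 2 (mod ℓ) by Fermat's little theorem.  Hence ℓ ∣ z, then ℓ ∣ x because ℓ ∤ p, and then
-- ℓ ∣ y.  Dividing by ℓ gives a smaller solution, so by infinite descent only the trivial one
-- exists.

open import Defs
open import Data.Nat using (ℕ; _%_; _/_)
open import Data.Nat.Primality using (Prime)
open import Data.Product using (_×_; ∃)
open import Relation.Nullary using (¬_)
open import Relation.Binary.PropositionalEquality using (_≡_)

module _ where
  open import Data.Nat
  open import Data.Nat.Properties
  open import Data.Nat.Divisibility
  open import Data.Nat.DivMod using (m≡m%n+[m/n]*n)
  open import Data.Nat.Primality using (euclidsLemma; prime⇒nonZero; prime⇒nonTrivial)
  open import Data.Nat.Combinatorics using (_C_; nC1≡n; nCn≡1; nCk+nC[k+1]≡[n+1]C[k+1])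
  open import Data.Nat.Induction using (<-wellFounded)
  open import Data.Nat.Solver using (module +-*-Solver)
  open import Data.Fin using (Fin; zero; suc; toℕ; inject₁; fromℕ)
  open import Data.Fin.Properties using (inject₁ℕ<; toℕ-fromℕ)
  open import Data.Vec.Functional using (Vector; init)
  open import Data.Product using (∃₂; _,_; proj₁; proj₂)
  open import Data.Sum using ([_,_]′)
  open import Function using (id; _∘_)
  open import Induction.InfiniteDescent using (Descent; descent∧wf⇒empty)
  open import Relation.Nullary using (yes; no; contradiction)
  open import Relation.Binary.PropositionalEquality
  import Algebra.Definitions.RawSemiring +-*-rawSemiring as Semiring
  import Algebra.Properties.Monoid.Sum +-0-monoid as Sum
  import Algebra.Properties.CommutativeSemiring.Binomial +-*-commutativeSemiring as Binomial
  open +-*-Solver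
  open ≡-Reasoning

  [1+k]*[1+n]C[1+k]≡[1+n]*nCk : ∀ n k → suc k * (suc n C suc k) ≡ suc n * (n C k)
  [1+k]*[1+n]C[1+k]≡[1+n]*nCk zero    zero    = refl
  [1+k]*[1+n]C[1+k]≡[1+n]*nCk zero    (suc k) = *-zeroʳ (2 + k)
  [1+k]*[1+n]C[1+k]≡[1+n]*nCk (suc n) zero    =
    trans (+-identityʳ _) (trans (nC1≡n (2 + n)) (sym (*-identityʳ (2 + n))))
  [1+k]*[1+n]C[1+k]≡[1+n]*nCk (suc n) (suc k) = begin
    (2 + k) * ((2 + n) C (2 + k))
      ≡⟨ cong ((2 + k) *_) (nCk+nC[k+1]≡[n+1]C[k+1] (suc n) (suc k)) ⟨
    (2 + k) * (a + b)
      ≡⟨ solve 3 (λ k a b → (con 2 :+ k) :* (a :+ b)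
                         := a :+ ((con 1 :+ k) :* a :+ (con 2 :+ k) :* b)) refl k a b ⟩
    a + ((1 + k) * a + (2 + k) * b)
      ≡⟨ cong₂ (λ u v → a + (u + v)) ([1+k]*[1+n]C[1+k]≡[1+n]*nCk n k)
                                     ([1+k]*[1+n]C[1+k]≡[1+n]*nCk n (suc k)) ⟩
    a + ((1 + n) * (n C k) + (1 + n) * (n C suc k))
      ≡⟨ cong (a +_) (*-distribˡ-+ (1 + n) (n C k) (n C suc k)) ⟨
    a + (1 + n) * (n C k + n C suc k)
      ≡⟨ cong (λ c → a + (1 + n) * c) (nCk+nC[k+1]≡[n+1]C[k+1] n k) ⟩
    (2 + n) * a ∎
    where
    a b : ℕ
    a = suc n C suc k
    b = suc n C (2 + k)

  prime∣pCk : ∀ {p k} → Prime p → 0 < k → k < p → p ∣ p C k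
  prime∣pCk {suc n} {suc k} p-prime _ k<p =
    [ (λ p∣k → contradiction (∣⇒≤ p∣k) (<⇒≱ k<p)) , id ]′
      (euclidsLemma (suc k) (suc n C suc k) p-prime
        (divides (n C k) (trans ([1+k]*[1+n]C[1+k]≡[1+n]*nCk n k) (*-comm (suc n) (n C k)))))

  prime∣m*m⇒∣m : ∀ {p m} → Prime p → p ∣ m * m → p ∣ m
  prime∣m*m⇒∣m {m = m} p-prime p∣m*m = [ id , id ]′ (euclidsLemma m m p-prime p∣m*m)

  ∣-sum : ∀ {d n} (f : Vector ℕ n) → (∀ i → d ∣ f i) → d ∣ Sum.sum f
  ∣-sum {d} {zero}  f _   = d ∣0
  ∣-sum {n = suc n} f d∣f = ∣m∣n⇒∣m+n (d∣f zero) (∣-sum (f ∘ suc) (d∣f ∘ suc))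

  ×ᴿ≡* : ∀ n x → n Semiring.× x ≡ n * x
  ×ᴿ≡* zero    x = refl
  ×ᴿ≡* (suc n) x = cong (x +_) (×ᴿ≡* n x)

  ^ᴿ≡^ : ∀ x n → x Semiring.^ n ≡ x ^ n
  ^ᴿ≡^ x zero    = refl
  ^ᴿ≡^ x (suc n) = cong (x *_) (^ᴿ≡^ x n)

  1^n≡1 : ∀ n → 1 ^ n ≡ 1
  1^n≡1 zero    = refl
  1^n≡1 (suc n) = trans (+-identityʳ (1 ^ n)) (1^n≡1 n)

  prime∣binomialTerm : ∀ {n} → Prime (suc n) → ∀ x y (i : Fin n) →
                       suc n ∣ Binomial.binomialTerm x y (suc n) (suc (inject₁ i))
  prime∣binomialTerm {n} p-prime x y i = subst (suc n ∣_) (sym (×ᴿ≡* (suc n C k) b))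
    (∣m⇒∣m*n b (prime∣pCk p-prime (s≤s z≤n) (s≤s (inject₁ℕ< i))))
    where
    k b : ℕ
    k = suc (toℕ (inject₁ i))
    b = Binomial.binomial x y (suc n) (suc (inject₁ i))

  freshmansDream : ∀ {p} → Prime p → ∀ x → ∃ λ q → (1 + x) ^ p ≡ 1 + x ^ p + q * p
  freshmansDream {p@(suc n)} p-prime x = q , (begin
    (1 + x) ^ p                                        ≡⟨ ^ᴿ≡^ (1 + x) p ⟨
    (1 + x) Semiring.^ p                               ≡⟨ Binomial.theorem p 1 x ⟩
    f zero + Sum.sum (f ∘ suc)                         ≡⟨ cong (f zero +_) (Sum.sum-init-last (f ∘ suc)) ⟩
    f zero + (Sum.sum (init (f ∘ suc)) + f (fromℕ p))
      ≡⟨ cong₂ (λ a b → a + (b + f (fromℕ p))) first (m∣n⇒n≡quotient*m p∣middle) ⟩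
    x ^ p + (q * p + f (fromℕ p))                      ≡⟨ cong (λ c → x ^ p + (q * p + c)) last ⟩
    x ^ p + (q * p + 1)
      ≡⟨ solve 2 (λ a b → a :+ (b :+ con 1) := con 1 :+ a :+ b) refl (x ^ p) (q * p) ⟩
    1 + x ^ p + q * p                                  ∎)
    where
    f : Vector ℕ (suc p)
    f = Binomial.binomialTerm 1 x p
    p∣middle : p ∣ Sum.sum (init (f ∘ suc))
    p∣middle = ∣-sum (init (f ∘ suc)) (prime∣binomialTerm p-prime 1 x)
    q : ℕ
    q = quotient p∣middle
    first : f zero ≡ x ^ p
    first = trans (+-identityʳ _) (trans (+-identityʳ _) (^ᴿ≡^ x p))
    last : f (fromℕ p) ≡ 1
    last rewrite toℕ-fromℕ n | nCn≡1 p | n∸n≡0 n =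
      trans (+-identityʳ _) (trans (*-identityʳ _) (trans (^ᴿ≡^ 1 p) (1^n≡1 p)))

  fermatsLittleTheorem : ∀ {p} → Prime p → ∀ x → ∃ λ q → x ^ p ≡ x + q * p
  fermatsLittleTheorem {suc n} p-prime zero    = 0 , refl
  fermatsLittleTheorem {p}     p-prime (suc x) =
    let q , [1+x]^p≡ = freshmansDream p-prime x
        r , x^p≡     = fermatsLittleTheorem p-prime x
    in  q + r , (begin
      (1 + x) ^ p              ≡⟨ [1+x]^p≡ ⟩
      1 + x ^ p + q * p        ≡⟨ cong (λ c → 1 + c + q * p) x^p≡ ⟩
      1 + (x + r * p) + q * p
        ≡⟨ solve 4 (λ x p q r → con 1 :+ (x :+ r :* p) :+ q :* p
                             := con 1 :+ x :+ (q :+ r) :* p) refl x p q r ⟩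
      1 + x + (q + r) * p      ∎)

  fermatsLittleTheorem′ : ∀ {p x} → Prime p → ¬ p ∣ x → ∃ λ r → x ^ (p ∸ 1) ≡ 1 + r * p
  fermatsLittleTheorem′ {suc n} {x} p-prime p∤x with x ^ n in x^n≡ | fermatsLittleTheorem p-prime x
  ... | zero  | _ = contradiction (subst (suc n ∣_) (sym (m^n≡0⇒m≡0 x n x^n≡)) (suc n ∣0)) p∤x
  ... | suc y | q , x*[1+y]≡x+q*p =
    [ (λ p∣x → contradiction p∣x p∤x) , (λ (divides r y≡r*p) → r , cong suc y≡r*p) ]′
      (euclidsLemma x y p-prime
        (divides q (+-cancelˡ-≡ x _ _ (trans (sym (*-suc x y)) x*[1+y]≡x+q*p))))

  m+n∣m^[1+2k]+n^[1+2k] : ∀ m n k → m + n ∣ m ^ (1 + k * 2) + n ^ (1 + k * 2)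
  m+n∣m^[1+2k]+n^[1+2k] m n zero    =
    subst (m + n ∣_) (sym (cong₂ _+_ (*-identityʳ m) (*-identityʳ n))) ∣-refl
  m+n∣m^[1+2k]+n^[1+2k] m n (suc k) =
    ∣m+n∣m⇒∣n (subst (m + n ∣_) expand (∣m⇒∣m*n (m * M + n * N) ∣-refl))
              (∣n⇒∣m*n (m * n) (m+n∣m^[1+2k]+n^[1+2k] m n k))
    where
    M N : ℕ
    M = m ^ (1 + k * 2)
    N = n ^ (1 + k * 2)
    expand : (m + n) * (m * M + n * N) ≡ m * n * (M + N) + (m * (m * M) + n * (n * N))
    expand = solve 4 (λ m n M N → (m :+ n) :* (m :* M :+ n :* N)
                                := m :* n :* (M :+ N) :+ (m :* (m :* M) :+ n :* (n :* N)))
                     refl m n M N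

  prime≡3[mod4]∣m*m+n*n⇒∣n : ∀ {p} → Prime p → p % 4 ≡ 3 → ∀ m n → p ∣ m * m + n * n → p ∣ n
  prime≡3[mod4]∣m*m+n*n⇒∣n {p} p-prime p%4≡3 m n p∣m*m+n*n with p ∣? n
  ... | yes p∣n = p∣n
  ... | no  p∤n = contradiction (∣⇒≤ p∣2) (<⇒≱ (subst (2 <_) (sym p≡3+k*4) (m≤m+n 3 (k * 4))))
    where
    k : ℕ
    k = p / 4
    p≡3+k*4 : p ≡ 3 + k * 4
    p≡3+k*4 = trans (m≡m%n+[m/n]*n p 4) (cong (_+ k * 4) p%4≡3)
    p∤m : ¬ p ∣ m
    p∤m p∣m = p∤n (prime∣m*m⇒∣m p-prime (∣m+n∣m⇒∣n p∣m*m+n*n (∣m⇒∣m*n m p∣m)))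
    square^[1+2k]≡^[p∸1] : ∀ a → (a * a) ^ (1 + k * 2) ≡ a ^ (p ∸ 1)
    square^[1+2k]≡^[p∸1] a = begin
      (a * a) ^ (1 + k * 2)   ≡⟨ cong (λ b → (a * b) ^ (1 + k * 2)) (*-identityʳ a) ⟨
      (a ^ 2) ^ (1 + k * 2)   ≡⟨ ^-*-assoc a 2 (1 + k * 2) ⟩
      a ^ (2 * (1 + k * 2))
        ≡⟨ cong (a ^_) (solve 1 (λ k → con 2 :* (con 1 :+ k :* con 2) := con 2 :+ k :* con 4) refl k) ⟩
      a ^ (2 + k * 4)         ≡⟨ cong (λ q → a ^ (q ∸ 1)) p≡3+k*4 ⟨
      a ^ (p ∸ 1)             ∎
    p∣2 : p ∣ 2
    p∣2 with r , m^[p∸1]≡ ← fermatsLittleTheorem′ p-prime p∤m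
           | s , n^[p∸1]≡ ← fermatsLittleTheorem′ p-prime p∤n =
      ∣m+n∣m⇒∣n (subst (p ∣_) sum≡ (∣-trans p∣m*m+n*n (m+n∣m^[1+2k]+n^[1+2k] (m * m) (n * n) k)))
                (∣m⇒∣m*n (r + s) ∣-refl)
      where
      sum≡ : (m * m) ^ (1 + k * 2) + (n * n) ^ (1 + k * 2) ≡ p * (r + s) + 2
      sum≡ = begin
        (m * m) ^ (1 + k * 2) + (n * n) ^ (1 + k * 2)
          ≡⟨ cong₂ _+_ (trans (square^[1+2k]≡^[p∸1] m) m^[p∸1]≡)
                       (trans (square^[1+2k]≡^[p∸1] n) n^[p∸1]≡) ⟩
        (1 + r * p) + (1 + s * p)
          ≡⟨ solve 3 (λ p r s → (con 1 :+ r :* p) :+ (con 1 :+ s :* p)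
                               := p :* (r :+ s) :+ con 2) refl p r s ⟩
        p * (r + s) + 2 ∎

  m*n*n≡0⇒n≡0 : ∀ m n .{{_ : NonZero m}} → m * n * n ≡ 0 → n ≡ 0
  m*n*n≡0⇒n≡0 m n m*n*n≡0 =
    [ (λ m*n≡0 → m*n≡0⇒m≡0 n m (trans (*-comm n m) m*n≡0)) , id ]′
      (m*n≡0⇒m≡0∨n≡0 (m * n) m*n*n≡0)

  module _ {p ℓ : ℕ} (ℓ-prime : Prime ℓ) (ℓ%4≡3 : ℓ % 4 ≡ 3)
           (ℓ∤p : ¬ ℓ ∣ p) (-p-square : ∃ λ t → ℓ ∣ t * t + p) where

    private instance
      ℓ-nonZero : NonZero ℓ
      ℓ-nonZero = prime⇒nonZero ℓ-prime
      ℓ-nonTrivial : NonTrivial ℓ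
      ℓ-nonTrivial = prime⇒nonTrivial ℓ-prime

    Solution : ℕ → ℕ → ℕ → Set
    Solution x y z = p * x * x + ℓ * y * y ≡ z * z

    Solvable : ℕ → Set
    Solvable z = ∃₂ λ x y → Solution x y z

    ℓ∣z : ∀ {x y z} → Solution x y z → ℓ ∣ z
    ℓ∣z {x} {y} {z} sol = prime≡3[mod4]∣m*m+n*n⇒∣n ℓ-prime ℓ%4≡3 (t * x) z
      (subst (ℓ ∣_) expand (∣m∣n⇒∣m+n (∣m⇒∣m*n (x * x) ℓ∣t*t+p) (∣m⇒∣m*n (y * y) ∣-refl)))
      where
      t : ℕ
      t = proj₁ -p-square
      ℓ∣t*t+p : ℓ ∣ t * t + p
      ℓ∣t*t+p = proj₂ -p-square
      expand : (t * t + p) * (x * x) + ℓ * (y * y) ≡ t * x * (t * x) + z * z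
      expand = trans (solve 5 (λ t p x ℓ y → (t :* t :+ p) :* (x :* x) :+ ℓ :* (y :* y)
                                          := t :* x :* (t :* x) :+ (p :* x :* x :+ ℓ :* y :* y))
                              refl t p x ℓ y)
                     (cong (t * x * (t * x) +_) sol)

    ℓ∣x : ∀ {x y z} → Solution x y z → ℓ ∣ x
    ℓ∣x {x} {y} {z} sol = prime∣m*m⇒∣m ℓ-prime
      ([ (λ ℓ∣p → contradiction ℓ∣p ℓ∤p) , id ]′ (euclidsLemma p (x * x) ℓ-prime ℓ∣p*[x*x]))
      where
      ℓ∣ℓ*y*y+p*x*x : ℓ ∣ ℓ * y * y + p * x * x
      ℓ∣ℓ*y*y+p*x*x = subst (ℓ ∣_) (trans (sym sol) (+-comm (p * x * x) (ℓ * y * y)))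
                             (∣m⇒∣m*n z (ℓ∣z {x} {y} {z} sol))
      ℓ∣p*[x*x] : ℓ ∣ p * (x * x)
      ℓ∣p*[x*x] = subst (ℓ ∣_) (*-assoc p x x)
        (∣m+n∣m⇒∣n ℓ∣ℓ*y*y+p*x*x (∣m⇒∣m*n y (∣m⇒∣m*n y ∣-refl)))

    ℓ∣y : ∀ {x y z} → Solution (x * ℓ) y (z * ℓ) → ℓ ∣ y
    ℓ∣y {x} {y} {z} sol = prime∣m*m⇒∣m ℓ-prime
      (∣m+n∣m⇒∣n (subst (ℓ ∣_) (sym cancelled) (∣m⇒∣m*n (z * z) ∣-refl)) (∣m⇒∣m*n (p * x * x) ∣-refl))
      where
      cancelled : ℓ * (p * x * x) + y * y ≡ ℓ * (z * z)
      cancelled = *-cancelˡ-≡ _ _ ℓ (begin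
        ℓ * (ℓ * (p * x * x) + y * y)
          ≡⟨ solve 4 (λ ℓ p x y → ℓ :* (ℓ :* (p :* x :* x) :+ y :* y)
                               := p :* (x :* ℓ) :* (x :* ℓ) :+ ℓ :* y :* y) refl ℓ p x y ⟩
        p * (x * ℓ) * (x * ℓ) + ℓ * y * y  ≡⟨ sol ⟩
        z * ℓ * (z * ℓ)
          ≡⟨ solve 2 (λ ℓ z → z :* ℓ :* (z :* ℓ) := ℓ :* (ℓ :* (z :* z))) refl ℓ z ⟩
        ℓ * (ℓ * (z * z))                  ∎)

    solution-÷ℓ : ∀ {x y z} → Solution (x * ℓ) (y * ℓ) (z * ℓ) → Solution x y z
    solution-÷ℓ {x} {y} {z} sol = *-cancelˡ-≡ _ _ (ℓ * ℓ) {{m*n≢0 ℓ ℓ}} (begin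
      ℓ * ℓ * (p * x * x + ℓ * y * y)
        ≡⟨ solve 4 (λ ℓ p x y → ℓ :* ℓ :* (p :* x :* x :+ ℓ :* y :* y)
                             := p :* (x :* ℓ) :* (x :* ℓ) :+ ℓ :* (y :* ℓ) :* (y :* ℓ)) refl ℓ p x y ⟩
      p * (x * ℓ) * (x * ℓ) + ℓ * (y * ℓ) * (y * ℓ)  ≡⟨ sol ⟩
      z * ℓ * (z * ℓ)
        ≡⟨ solve 2 (λ ℓ z → z :* ℓ :* (z :* ℓ) := ℓ :* ℓ :* (z :* z)) refl ℓ z ⟩
      ℓ * ℓ * (z * z)                                ∎)

    solvable-÷ℓ : ∀ {x y z} → Solution x y z → ∃ λ z′ → z ≡ z′ * ℓ × Solvable z′
    solvable-÷ℓ {x} {y} {z} sol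
      with divides x′ refl ← ℓ∣x {x} {y} {z} sol | divides z′ refl ← ℓ∣z {x} {y} {z} sol
      with divides y′ refl ← ℓ∣y {x′} {y} {z′} sol =
      z′ , refl , x′ , y′ , solution-÷ℓ {x′} {y′} {z′} sol

    nonzero-solvable-descent : Descent _<_ (λ z → NonZero z × Solvable z)
    nonzero-solvable-descent {z} (z≢0 , x , y , sol)
      with z′ , refl , solvable ← solvable-÷ℓ {x} {y} {z} sol =
      z′ , m<m*n z′ ℓ {{z′≢0}} (nonTrivial⇒n>1 ℓ) , z′≢0 , solvable
      where
      z′≢0 : NonZero z′
      z′≢0 = m*n≢0⇒m≢0 z′ {{z≢0}}

    solution⇒z≡0 : ∀ {x y z} → Solution x y z → z ≡ 0
    solution⇒z≡0 {z = zero}          _   = refl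
    solution⇒z≡0 {x} {y} {z = suc z} sol =
      contradiction (_ , x , y , sol) (descent∧wf⇒empty nonzero-solvable-descent <-wellFounded (suc z))

    solution⇒trivial : ∀ {x y z} → Solution x y z → x ≡ 0 × y ≡ 0 × z ≡ 0
    solution⇒trivial {x} {y} {z} sol with refl ← solution⇒z≡0 {x} {y} {z} sol =
      m*n*n≡0⇒n≡0 p x {{p≢0}} (m+n≡0⇒m≡0 _ sol) , m*n*n≡0⇒n≡0 ℓ y (m+n≡0⇒n≡0 _ sol) , refl
      where
      p≢0 : NonZero p
      p≢0 = ≢-nonZero (λ p≡0 → ℓ∤p (subst (ℓ ∣_) (sym p≡0) (ℓ ∣0)))

open import Data.Integer using (ℤ; +_; -_; _*_; _+_; -[1+_]; ∣_∣)
import Data.Nat as ℕ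
import Data.Nat.Properties as ℕ
import Data.Nat.Divisibility as ℕ
open import Data.Nat.DivMod using (m/n*n≡m; %-distribˡ-+)
open import Data.Integer.Properties
  using (pos-*; neg-involutive; ∣-i∣≡∣i∣; ∣i∣≡0⇒i≡0; *-cancelˡ-≡; +-identityʳ; *-assoc)
open import Data.Integer.Solver using (module +-*-Solver)
open import Data.Product using (_,_)
open import Relation.Binary.PropositionalEquality
  using (refl; sym; trans; cong; cong₂; subst; module ≡-Reasoning)
open +-*-Solver
open ≡-Reasoning

i*i≡+∣i∣*∣i∣ : ∀ i → i * i ≡ + (∣ i ∣ ℕ.* ∣ i ∣)
i*i≡+∣i∣*∣i∣ (+ n)    = sym (pos-* n n)
i*i≡+∣i∣*∣i∣ -[1+ n ] = refl

+n*i*i≡+[n*∣i∣*∣i∣] : ∀ n i → + n * i * i ≡ + (n ℕ.* ∣ i ∣ ℕ.* ∣ i ∣)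
+n*i*i≡+[n*∣i∣*∣i∣] n i = begin
  + n * i * i                  ≡⟨ *-assoc (+ n) i i ⟩
  + n * (i * i)                ≡⟨ cong (+ n *_) (i*i≡+∣i∣*∣i∣ i) ⟩
  + n * + (∣ i ∣ ℕ.* ∣ i ∣)    ≡⟨ pos-* n (∣ i ∣ ℕ.* ∣ i ∣) ⟨
  + (n ℕ.* (∣ i ∣ ℕ.* ∣ i ∣))  ≡⟨ cong +_ (ℕ.*-assoc n ∣ i ∣ ∣ i ∣) ⟨
  + (n ℕ.* ∣ i ∣ ℕ.* ∣ i ∣)    ∎

splitsIn[-p]⇒∤p×∣t*t+p : ∀ {ℓ p} → SplitsIn ℓ (- + p) → ¬ ℓ ℕ.∣ p × ∃ λ t → ℓ ℕ.∣ t ℕ.* t ℕ.+ p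
splitsIn[-p]⇒∤p×∣t*t+p {ℓ} {p} (ℓ∤-p , t , ℓ∣t*t-[-p]) =
  (λ ℓ∣p → ℓ∤-p (subst (ℓ ℕ.∣_) (sym (∣-i∣≡∣i∣ (+ p))) ℓ∣p)) ,
  ∣ t ∣ , subst (ℓ ℕ.∣_) (cong ∣_∣ t*t-[-p]≡) ℓ∣t*t-[-p]
  where
  t*t-[-p]≡ : t * t + - - + p ≡ + (∣ t ∣ ℕ.* ∣ t ∣ ℕ.+ p)
  t*t-[-p]≡ = trans (cong (λ j → t * t + j) (neg-involutive (+ p))) (cong (_+ + p) (i*i≡+∣i∣*∣i∣ t))

px²+ℓy²≡z²⇒trivial : ∀ {p ℓ} → Prime ℓ → ℓ % 4 ≡ 3 → SplitsIn ℓ (- + p) →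
                     ∀ {x y z} → + p * x * x + + ℓ * y * y ≡ z * z → x ≡ + 0 × y ≡ + 0 × z ≡ + 0
px²+ℓy²≡z²⇒trivial {p} {ℓ} ℓ-prime ℓ%4≡3 splits {x} {y} {z} eq =
  let ℓ∤p , -p-square = splitsIn[-p]⇒∤p×∣t*t+p splits
      ∣x∣≡0 , ∣y∣≡0 , ∣z∣≡0 = solution⇒trivial ℓ-prime ℓ%4≡3 ℓ∤p -p-square {∣ x ∣} {∣ y ∣} {∣ z ∣}
        (cong ∣_∣ (begin
          + (p ℕ.* ∣ x ∣ ℕ.* ∣ x ∣ ℕ.+ ℓ ℕ.* ∣ y ∣ ℕ.* ∣ y ∣)
            ≡⟨ cong₂ _+_ (+n*i*i≡+[n*∣i∣*∣i∣] p x) (+n*i*i≡+[n*∣i∣*∣i∣] ℓ y) ⟨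
          + p * x * x + + ℓ * y * y  ≡⟨ eq ⟩
          z * z                      ≡⟨ i*i≡+∣i∣*∣i∣ z ⟩
          + (∣ z ∣ ℕ.* ∣ z ∣)        ∎))
  in  ∣i∣≡0⇒i≡0 ∣x∣≡0 , ∣i∣≡0⇒i≡0 ∣y∣≡0 , ∣i∣≡0⇒i≡0 ∣z∣≡0

4[px²+pxy+cy²]≡p[2x+y]²+ℓy² : ∀ {p ℓ c} → p + ℓ ≡ c * + 4 → ∀ x y →
  + 4 * (p * x * x + p * x * y + c * y * y) ≡ p * (+ 2 * x + y) * (+ 2 * x + y) + ℓ * y * y
4[px²+pxy+cy²]≡p[2x+y]²+ℓy² {p} {ℓ} {c} p+ℓ≡c*4 x y = begin
  + 4 * (p * x * x + p * x * y + c * y * y)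
    ≡⟨ solve 4 (λ p c x y → con (+ 4) :* (p :* x :* x :+ p :* x :* y :+ c :* y :* y)
                         := con (+ 4) :* (p :* x :* x :+ p :* x :* y) :+ c :* con (+ 4) :* y :* y)
               refl p c x y ⟩
  + 4 * (p * x * x + p * x * y) + c * + 4 * y * y
    ≡⟨ cong (λ d → + 4 * (p * x * x + p * x * y) + d * y * y) p+ℓ≡c*4 ⟨
  + 4 * (p * x * x + p * x * y) + (p + ℓ) * y * y
    ≡⟨ solve 4 (λ p ℓ x y → con (+ 4) :* (p :* x :* x :+ p :* x :* y) :+ (p :+ ℓ) :* y :* y
                         := p :* (con (+ 2) :* x :+ y) :* (con (+ 2) :* x :+ y) :+ ℓ :* y :* y)
               refl p ℓ x y ⟩
  p * (+ 2 * x + y) * (+ 2 * x + y) + ℓ * y * y ∎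

px²+pxy+cy²≡z²⇒trivial : ∀ {p ℓ c} → Prime ℓ → ℓ % 4 ≡ 3 → SplitsIn ℓ (- + p) →
                         p ℕ.+ ℓ ≡ c ℕ.* 4 →
                         ∀ {x y z} → + p * x * x + + p * x * y + + c * y * y ≡ z * z →
                         x ≡ + 0 × y ≡ + 0 × z ≡ + 0
px²+pxy+cy²≡z²⇒trivial {p} {ℓ} {c} ℓ-prime ℓ%4≡3 splits p+ℓ≡c*4 {x} {y} {z} eq =
  let 2x+y≡0 , y≡0 , 2z≡0 =
        px²+ℓy²≡z²⇒trivial ℓ-prime ℓ%4≡3 splits {+ 2 * x + y} {y} {+ 2 * z} diagonal
      2x≡0 : + 2 * x ≡ + 0
      2x≡0 = trans (sym (+-identityʳ (+ 2 * x))) (trans (cong (λ j → + 2 * x + j) (sym y≡0)) 2x+y≡0)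
  in  *-cancelˡ-≡ (+ 2) x (+ 0) 2x≡0 , y≡0 , *-cancelˡ-≡ (+ 2) z (+ 0) 2z≡0
  where
  diagonal : + p * (+ 2 * x + y) * (+ 2 * x + y) + + ℓ * y * y ≡ + 2 * z * (+ 2 * z)
  diagonal = begin
    + p * (+ 2 * x + y) * (+ 2 * x + y) + + ℓ * y * y
      ≡⟨ 4[px²+pxy+cy²]≡p[2x+y]²+ℓy² {+ p} {+ ℓ} {+ c} (trans (cong +_ p+ℓ≡c*4) (pos-* c 4)) x y ⟨
    + 4 * (+ p * x * x + + p * x * y + + c * y * y)  ≡⟨ cong (+ 4 *_) eq ⟩
    + 4 * (z * z)
      ≡⟨ solve 1 (λ z → con (+ 4) :* (z :* z) := con (+ 2) :* z :* (con (+ 2) :* z)) refl z ⟩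
    + 2 * z * (+ 2 * z)                              ∎

lemma3p2 : (p ℓ : ℕ) → Prime p → p % 4 ≡ 1 → Prime ℓ → ℓ % 4 ≡ 3 →
    SplitsIn ℓ (- (+ p)) → SplitsIn ℓ (- (+ (4 Data.Nat.* p))) →
    (¬ ∃ λ (x : ℤ) → ∃ λ (y : ℤ) → ∃ λ (z : ℤ) →
        ¬ (x ≡ + 0 × y ≡ + 0 × z ≡ + 0) ×
        (+ p) * x * x + (+ ℓ) * y * y ≡ z * z)
    × (¬ ∃ λ (x : ℤ) → ∃ λ (y : ℤ) → ∃ λ (z : ℤ) →
        ¬ (x ≡ + 0 × y ≡ + 0 × z ≡ + 0) ×
        (+ p) * x * x + (+ p) * x * y + (+ ((p Data.Nat.+ ℓ) / 4)) * y * y ≡ z * z)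
lemma3p2 p ℓ _ p%4≡1 ℓ-prime ℓ%4≡3 splits _ =
    (λ (x , y , z , nontrivial , eq) →
      nontrivial (px²+ℓy²≡z²⇒trivial ℓ-prime ℓ%4≡3 splits {x} {y} {z} eq))
  , (λ (x , y , z , nontrivial , eq) →
      nontrivial (px²+pxy+cy²≡z²⇒trivial {c = (p ℕ.+ ℓ) / 4} ℓ-prime ℓ%4≡3 splits p+ℓ≡[p+ℓ]/4*4
                                          {x} {y} {z} eq))
  where
  p+ℓ≡[p+ℓ]/4*4 : p ℕ.+ ℓ ≡ (p ℕ.+ ℓ) / 4 ℕ.* 4
  p+ℓ≡[p+ℓ]/4*4 = sym (m/n*n≡m (ℕ.m%n≡0⇒n∣m (p ℕ.+ ℓ) 4
    (trans (%-distribˡ-+ p ℓ 4) (cong₂ (λ a b → (a ℕ.+ b) % 4) p%4≡1 ℓ%4≡3))))
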